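{- Consider a Bounded Knapsack Problem instance with items $\{1,\dots,n\}$ (positive integer profits $p_i$, weights $w_i$, availabilities $d_i$), capacity $W$, items indexed in non-increasing order of efficiency $p_i/w_i$, break item $b$, incumbent value $z$, and unfixed availability vector $u$ (as in the context). Let $\widehat p=\sum_{i<b}d_ip_i$, $\widehat w=\sum_{i<b}d_iw_i$, and for a left item $i$ (i.e. $i<b$) and integer $e\ge 0$ define the weak upper bound $$WB(i,e)=\widehat p-e\,p_i+\bigl(W-\widehat w+e\,w_i\bigr)\frac{p_b}{w_b}.$$ Let $I^1_{\text{left}}$ be the set of left items $i$ with $u_i=1$. Suppose that for every $i\in I^1_{\text{left}}$ we have $WB(i,1)\ge z+1$ and $WB(i,2)<z+1$. Then no two distinct items $i,i'\in I^1_{\text{left}}$ can be removed simultaneously while maintaining a weak upper bound of at least $z+1$, i.e. for all distinct $i,i'\in I^1_{\text{left}}$, $$\widehat p-p_i-p_{i'}+\bigl(W-\widehat w+w_i+w_{i'}\bigr)\frac{p_b}{w_b}<z+1.$$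
   Context: The break item $b$ is the index with $\sum_{i<b}d_iw_i\le W<\sum_{i\le b}d_iw_i$; items $i<b$ are left items and items $i\ge b$ right items. An improved solution is an integer $x$ with $0\le x_i\le d_i$, $\sum_iw_ix_i\le W$ and $\sum_ip_ix_i\ge z+1$. The unfixed availability vector $u\in\mathbb{Z}^n$, $0\le u_i\le d_i$, is such that every improved solution satisfies $d_i-u_i\le x_i\le d_i$ for left items $i$ and $x_i\le u_i$ for right items $i$. -}

module Defs where

open import Data.Nat as ℕ using (ℕ; _<_; _≤_; _∸_; _+_; _*_; NonZero)
open import Data.Nat.Properties using (_<?_)
open import Data.Fin using (Fin; toℕ)
open import Data.List using (List; map; filter; allFin)
open import Data.Nat.ListAction using (sum)
open import Data.Integer using (+_)
open import Data.Product using (_×_)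
import Data.Rational as ℚ
open ℚ using (ℚ)

record BKP : Set where
  field
    n    : ℕ
    p    : Fin n → ℕ
    w    : Fin n → ℕ
    d    : Fin n → ℕ
    W    : ℕ
    p-pos : ∀ i → 0 < p i
    w-pos : ∀ i → NonZero (w i)
    d-pos : ∀ i → 0 < d i

  eff : Fin n → ℚ
  eff i = (+ p i) ℚ./ w i
    where instance _ = w-pos i

  sumBelow : ℕ → (Fin n → ℕ) → ℕ
  sumBelow k f = sum (map f (filter (λ i → toℕ i <? k) (allFin n)))

  SortedByEfficiency : Set
  SortedByEfficiency = ∀ (i j : Fin n) → toℕ i ≤ toℕ j → eff j ℚ.≤ eff i

  IsBreakItem : Fin n → Set
  IsBreakItem b = sumBelow (toℕ b) (λ i → d i * w i) ≤ W
                × W < sumBelow (ℕ.suc (toℕ b)) (λ i → d i * w i)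

  Improved : ℕ → (Fin n → ℕ) → Set
  Improved z x = (∀ i → x i ≤ d i)
               × sumBelow n (λ i → w i * x i) ≤ W
               × z + 1 ≤ sumBelow n (λ i → p i * x i)

  IsUnfixedAvailability : Fin n → ℕ → (Fin n → ℕ) → Set
  IsUnfixedAvailability b z u =
      (∀ i → u i ≤ d i)
    × (∀ x → Improved z x → ∀ i →
         (toℕ i < toℕ b → (d i ∸ u i ≤ x i) × (x i ≤ d i))
       × (toℕ b ≤ toℕ i → x i ≤ u i))

  ℕ→ℚ : ℕ → ℚ
  ℕ→ℚ k = (+ k) ℚ./ 1

  phat : Fin n → ℕ
  phat b = sumBelow (toℕ b) (λ i → d i * p i)

  what : Fin n → ℕ
  what b = sumBelow (toℕ b) (λ i → d i * w i)

  WB : (b : Fin n) → Fin n → ℕ → ℚ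
  WB b i e = (ℕ→ℚ (phat b) ℚ.- ℕ→ℚ (e * p i))
       ℚ.+ (ℕ→ℚ W ℚ.- ℕ→ℚ (what b) ℚ.+ ℕ→ℚ (e * w i)) ℚ.* eff b

  WBpair : (b : Fin n) → Fin n → Fin n → ℚ
  WBpair b i i' = (ℕ→ℚ (phat b) ℚ.- ℕ→ℚ (p i) ℚ.- ℕ→ℚ (p i'))
       ℚ.+ (ℕ→ℚ W ℚ.- ℕ→ℚ (what b) ℚ.+ ℕ→ℚ (w i) ℚ.+ ℕ→ℚ (w i')) ℚ.* eff b

  InI1left : Fin n → (Fin n → ℕ) → Fin n → Set
  InI1left b u i = (toℕ i < toℕ b) × (u i ≡ 1)
    where open import Relation.Binary.PropositionalEquality using (_≡_)

-- Removing an item i from the left part of the greedy solution changes the weak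
-- bound affinely in its profit and weight, so WB(i,2) + WB(i',2) is exactly twice
-- the bound obtained by removing i and i' once each. Both summands are below
-- z + 1, hence so is their average.
module Submission where

open import Defs
open import Data.Nat using (ℕ; _+_)
open import Data.Fin using (Fin)
open import Relation.Binary.PropositionalEquality using (_≢_)
open import Data.Product using (_×_)
import Data.Rational as ℚ

open import Data.Product using (proj₂)
open import Relation.Nullary using (yes; no; contradiction)
open import Relation.Binary.PropositionalEquality
  using (_≡_; refl; cong; cong₂; sym; trans; module ≡-Reasoning)
open import Data.Integer using (+_)
import Data.Integer as ℤ
import Data.Integer.Properties as ℤP
import Data.Nat as ℕ
import Data.Nat.Properties as ℕP
import Data.Nat.Coprimality as Coprimality
open import Data.Rational using (ℚ; mkℚ; _-_; _*_; _<_)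
  renaming (_+_ to _+ℚ_)
import Data.Rational.Properties as ℚP
open import Data.Rational.Solver using (module +-*-Solver)

fromℕ : ℕ → ℚ
fromℕ k = (+ k) ℚ./ 1

fromℕ≡mkℚ : ∀ k → fromℕ k ≡ mkℚ (+ k) 0 (Coprimality.sym (Coprimality.1-coprimeTo k))
fromℕ≡mkℚ k = ℚP.normalize-coprime (Coprimality.sym (Coprimality.1-coprimeTo k))

fromℕ-homo-+ : ∀ m n → fromℕ (m + n) ≡ fromℕ m +ℚ fromℕ n
fromℕ-homo-+ m n rewrite fromℕ≡mkℚ m | fromℕ≡mkℚ n =
  sym (cong (ℚ._/ 1) (cong₂ ℤ._+_ (ℤP.*-identityʳ (+ m)) (ℤP.*-identityʳ (+ n))))

fromℕ-double : ∀ m → fromℕ (2 ℕ.* m) ≡ fromℕ m +ℚ fromℕ m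
fromℕ-double m = trans (cong (λ k → fromℕ (m + k)) (ℕP.+-identityʳ m)) (fromℕ-homo-+ m m)

x+x<y+y⇒x<y : ∀ {x y : ℚ} → x +ℚ x < y +ℚ y → x < y
x+x<y+y⇒x<y {x} {y} x+x<y+y with x ℚP.<? y
... | yes x<y = x<y
... | no x≮y  = contradiction (ℚP.<-≤-trans x+x<y+y (ℚP.+-mono-≤ y≤x y≤x)) (ℚP.<-irrefl refl)
  where y≤x = ℚP.≮⇒≥ x≮y

open +-*-Solver

double-removal-midpoint : ∀ P C r a a′ v v′ →
  (P - (a +ℚ a) +ℚ (C +ℚ (v +ℚ v)) * r) +ℚ (P - (a′ +ℚ a′) +ℚ (C +ℚ (v′ +ℚ v′)) * r)
  ≡ (P - a - a′ +ℚ (C +ℚ v +ℚ v′) * r) +ℚ (P - a - a′ +ℚ (C +ℚ v +ℚ v′) * r)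
double-removal-midpoint = solve 7 (λ P C r a a′ v v′ →
  (P :- (a :+ a) :+ (C :+ (v :+ v)) :* r) :+ (P :- (a′ :+ a′) :+ (C :+ (v′ :+ v′)) :* r)
  := (P :- a :- a′ :+ (C :+ v :+ v′) :* r) :+ (P :- a :- a′ :+ (C :+ v :+ v′) :* r)) refl

module _ (I : BKP) where
  open BKP I

  WB-2-sum : ∀ b i i′ → WB b i 2 +ℚ WB b i′ 2 ≡ WBpair b i i′ +ℚ WBpair b i i′
  WB-2-sum b i i′ = begin
    WB b i 2 +ℚ WB b i′ 2
      ≡⟨ cong₂ _+ℚ_ (WB-2 i) (WB-2 i′) ⟩
    (P - (fromℕ (p i) +ℚ fromℕ (p i)) +ℚ (C +ℚ (fromℕ (w i) +ℚ fromℕ (w i))) * eff b)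
      +ℚ (P - (fromℕ (p i′) +ℚ fromℕ (p i′)) +ℚ (C +ℚ (fromℕ (w i′) +ℚ fromℕ (w i′))) * eff b)
      ≡⟨ double-removal-midpoint P C (eff b) (fromℕ (p i)) (fromℕ (p i′)) (fromℕ (w i)) (fromℕ (w i′)) ⟩
    WBpair b i i′ +ℚ WBpair b i i′ ∎
    where
    open ≡-Reasoning
    P = fromℕ (phat b)
    C = fromℕ W - fromℕ (what b)
    WB-2 : ∀ j → WB b j 2
               ≡ P - (fromℕ (p j) +ℚ fromℕ (p j)) +ℚ (C +ℚ (fromℕ (w j) +ℚ fromℕ (w j))) * eff b
    WB-2 j = cong₂ (λ s t → P - s +ℚ (C +ℚ t) * eff b) (fromℕ-double (p j)) (fromℕ-double (w j))

theorem2 : (I : BKP) → let open BKP I in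
    (sorted : SortedByEfficiency) →
    (b : Fin n) → IsBreakItem b →
    (z : ℕ) → (u : Fin n → ℕ) → IsUnfixedAvailability b z u →
    (∀ i → InI1left b u i →
    (ℕ→ℚ (z + 1) ℚ.≤ WB b i 1) × (WB b i 2 ℚ.< ℕ→ℚ (z + 1))) →
    ∀ i i' → InI1left b u i → InI1left b u i' → i ≢ i' →
    WBpair b i i' ℚ.< ℕ→ℚ (z + 1)
theorem2 I _ b _ z _ _ bounds i i' i∈I¹ i'∈I¹ _ = x+x<y+y⇒x<y (begin-strict
  WBpair b i i' +ℚ WBpair b i i'  ≡⟨ sym (WB-2-sum I b i i') ⟩
  WB b i 2 +ℚ WB b i' 2           <⟨ ℚP.+-mono-< (proj₂ (bounds i i∈I¹)) (proj₂ (bounds i' i'∈I¹)) ⟩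
  fromℕ (z + 1) +ℚ fromℕ (z + 1)  ∎)
  where
  open BKP I
  open ℚP.≤-Reasoning
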